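{- Every pseudo-convex benzenoid is quasi-convex, but there exist quasi-convex benzenoids that are not pseudo-convex.
   Context: A fusene is a simple subcubic $2$-connected plane graph in which all bounded faces are hexagons and all vertices not on the outer face have degree $3$. A benzenoid is a fusene that is a subgraph of the infinite hexagonal lattice. The boundary-edges code of a benzenoid is obtained by traversing the perimeter and recording, for each pair of successive degree-$3$ vertices on the perimeter, the number of boundary edges between them (lexicographically maximal over starting vertex and direction); it is regarded cyclically. A benzenoid $B$ with code $c$ is $k$-convex ($k\ge0$) if every block of $k+1$ cyclically consecutive entries of $c$ has average at least $2$; the convexity deficit $\mathrm{cd}(B)$ is the minimum such $k$. $B$ is quasi-convex if $\mathrm{cd}(B)=1$. $B$ is pseudo-convex if its boundary-edges code contains at least one entry $1$, contains no entry $2$, and contains no two cyclically consecutive entries $11$. -}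

module Defs where

open import Data.Nat using (ℕ; zero; suc; _+_; _*_; _≤_; _<_; _⊔_; _%_)
open import Data.Integer as ℤ using (ℤ; ∣_∣)
import Data.Integer.Properties as ℤP
open import Data.Bool using (Bool; true; false)
open import Data.List using (List; []; _∷_; length; map)
open import Data.List.Membership.Propositional using (_∈_; _∉_)
import Data.List.Membership.DecPropositional as DecMem
open import Data.List.Relation.Unary.All using (All; all?)
open import Data.List.Relation.Unary.Unique.Propositional using (Unique)
open import Data.List.Relation.Binary.Lex.NonStrict using (Lex-≤)
open import Data.Product using (Σ; ∃; ∃-syntax; _×_; _,_; proj₁; proj₂)
open import Data.Product.Properties using (≡-dec)
open import Data.Sum using (_⊎_; inj₁; inj₂)
import Data.Sum.Properties as SumP
open import Data.Empty using (⊥)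
open import Relation.Nullary using (¬_; Dec; yes; no)
open import Relation.Nullary.Decidable using (isYes; _⊎-dec_)
open import Relation.Binary.PropositionalEquality using (_≡_; _≢_)

-- Hexagons (faces of the honeycomb) are indexed by axial coordinates
-- (q , r) ∈ ℤ × ℤ; their centres form a triangular lattice.  Two hexagons
-- share an edge iff their coordinates differ by one of six directions.

Hex : Set
Hex = ℤ × ℤ

_≟H_ : (h g : Hex) → Dec (h ≡ g)
_≟H_ = ≡-dec ℤ._≟_ ℤ._≟_

open DecMem _≟H_ using (_∈?_)

dirs : List Hex
dirs = (ℤ.+ 1 , ℤ.+ 0) ∷ (ℤ.- ℤ.+ 1 , ℤ.+ 0) ∷ (ℤ.+ 0 , ℤ.+ 1) ∷ (ℤ.+ 0 , ℤ.- ℤ.+ 1)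
     ∷ (ℤ.+ 1 , ℤ.- ℤ.+ 1) ∷ (ℤ.- ℤ.+ 1 , ℤ.+ 1) ∷ []

HexAdj : Hex → Hex → Set
HexAdj (q , r) g = ∃[ d ] (d ∈ dirs × g ≡ (q ℤ.+ proj₁ d , r ℤ.+ proj₂ d))

-- hexagonal distance from the origin hexagon
norm : Hex → ℕ
norm (q , r) = ∣ q ∣ ⊔ ∣ r ∣ ⊔ ∣ q ℤ.+ r ∣

-- Vertices of the honeycomb are the triangles of the triangular lattice of
-- hexagon centres:  (q , r , true)  is the "up" triangle
-- {(q,r), (q+1,r), (q,r+1)} and  (q , r , false)  the "down" triangle
-- {(q+1,r), (q,r+1), (q+1,r+1)}; a vertex is the common corner of the three
-- hexagons of its triangle.
Vtx : Set
Vtx = ℤ × ℤ × Bool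

private
  1ℤ : ℤ
  1ℤ = ℤ.+ 1

-- the three honeycomb neighbours of a vertex, each together with the two
-- hexagons sharing the connecting lattice edge
nbrs : Vtx → List (Vtx × Hex × Hex)
nbrs (q , r , true) =
    ((q , r , false)             , (q ℤ.+ 1ℤ , r) , (q , r ℤ.+ 1ℤ))
  ∷ ((q ℤ.- 1ℤ , r , false)      , (q , r) , (q , r ℤ.+ 1ℤ))
  ∷ ((q , r ℤ.- 1ℤ , false)      , (q , r) , (q ℤ.+ 1ℤ , r))
  ∷ []
nbrs (q , r , false) =
    ((q , r , true)              , (q ℤ.+ 1ℤ , r) , (q , r ℤ.+ 1ℤ))
  ∷ ((q ℤ.+ 1ℤ , r , true)       , (q ℤ.+ 1ℤ , r) , (q ℤ.+ 1ℤ , r ℤ.+ 1ℤ))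
  ∷ ((q , r ℤ.+ 1ℤ , true)       , (q , r ℤ.+ 1ℤ) , (q ℤ.+ 1ℤ , r ℤ.+ 1ℤ))
  ∷ []

LatEdge : Vtx → Vtx → Hex → Hex → Set
LatEdge v w a b = (w , a , b) ∈ nbrs v

-- The graph of the
-- benzenoid is the union of the boundaries of the hexagons in H: a lattice
-- edge belongs to it iff one of its two hexagons is in H.

data HexPath (P : Hex → Set) : Hex → Hex → Set where
  here  : ∀ {h} → P h → HexPath P h h
  step  : ∀ {h h′ g} → P h → HexAdj h h′ → HexPath P h′ g → HexPath P h g

record Benzenoid : Set where
  field
    hexes     : List Hex
    nonEmpty  : ∃[ h ] (h ∈ hexes)
    connected : ∀ h g → h ∈ hexes → g ∈ hexes → HexPath (_∈ hexes) h g
    -- no holes: every hexagon not in H is joined, avoiding H, to a hexagon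
    -- lying outside every hexagon of H (i.e. it lies in the outer face);
    -- hence all bounded faces of the graph are the hexagons of H
    holeFree  : ∀ h → h ∉ hexes →
                ∃[ g ] ((∀ k → k ∈ hexes → norm k Data.Nat.< norm g)
                        × HexPath (_∉ hexes) h g)
open Benzenoid public

module _ (B : Benzenoid) where
  private H = hexes B

  EdgeOf : Hex → Hex → Set
  EdgeOf a b = a ∈ H ⊎ b ∈ H

  PerimEdge : Hex → Hex → Set
  PerimEdge a b = (a ∈ H × b ∉ H) ⊎ (a ∉ H × b ∈ H)

  Deg3 : Vtx → Set
  Deg3 v = All (λ e → EdgeOf (proj₁ (proj₂ e)) (proj₂ (proj₂ e))) (nbrs v)

  deg3? : (v : Vtx) → Dec (Deg3 v)
  deg3? v = all? (λ e → (proj₁ (proj₂ e) ∈? H) ⊎-dec (proj₂ (proj₂ e) ∈? H)) (nbrs v)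

nthD : {A : Set} → A → List A → ℕ → A
nthD d []       _       = d
nthD d (x ∷ xs) zero    = x
nthD d (x ∷ xs) (suc i) = nthD d xs i

cyc : {A : Set} → A → List A → ℕ → A
cyc d []         i = d
cyc d (x ∷ xs)   i = nthD d (x ∷ xs) (i % suc (length xs))

dummyV : Vtx
dummyV = (ℤ.+ 0 , ℤ.+ 0 , true)

module _ (B : Benzenoid) where

  record PerimTraversal (vs : List Vtx) : Set where
    field
      distinct : Unique vs
      steps    : ∀ i → i < length vs →
                 ∃[ a ] ∃[ b ] (LatEdge (cyc dummyV vs i) (cyc dummyV vs (suc i)) a b
                                × PerimEdge B a b)
      covers   : ∀ v w a b → LatEdge v w a b → PerimEdge B a b →
                 ∃[ i ] (i < length vs ×
                   ((cyc dummyV vs i ≡ v × cyc dummyV vs (suc i) ≡ w)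
                    ⊎ (cyc dummyV vs i ≡ w × cyc dummyV vs (suc i) ≡ v)))

  flags : List Vtx → List Bool
  flags = map (λ v → isYes (deg3? B v))

-- Given the flags of a traversal starting at a degree-3 vertex, record for
-- each pair of successive degree-3 vertices the number of edges between them
-- (the last entry wraps around back to the starting vertex).
gapsAux : List Bool → ℕ × List ℕ
gapsAux []           = (0 , [])
gapsAux (false ∷ bs) = (suc (proj₁ (gapsAux bs)) , proj₂ (gapsAux bs))
gapsAux (true  ∷ bs) = (0 , suc (proj₁ (gapsAux bs)) ∷ proj₂ (gapsAux bs))

gaps : List Bool → List ℕ
gaps bs = proj₂ (gapsAux bs)

module _ (B : Benzenoid) where

  IsGapSeq : List ℕ → Set
  IsGapSeq c = ∃[ v ] ∃[ vs ] (PerimTraversal B (v ∷ vs) × Deg3 B v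
                               × c ≡ gaps (flags B (v ∷ vs)))

  IsCode : List ℕ → Set
  IsCode c = IsGapSeq c × (∀ c′ → IsGapSeq c′ → Lex-≤ _≡_ Data.Nat._≤_ c′ c)

blockSum : List ℕ → ℕ → ℕ → ℕ
blockSum c i zero    = 0
blockSum c i (suc k) = cyc 0 c i + blockSum c (suc i) k

KConvex : ℕ → List ℕ → Set
KConvex k c = ∀ i → i < length c → 2 * suc k ≤ blockSum c i (suc k)

HasCD : List ℕ → ℕ → Set
HasCD c d = KConvex d c × (∀ k → k < d → ¬ KConvex k c)

QuasiConvex : Benzenoid → Set
QuasiConvex B = ∃[ c ] (IsCode B c × HasCD c 1)

No11 : List ℕ → Set
No11 c = ∀ i → i < length c → ¬ (cyc 0 c i ≡ 1 × cyc 0 c (suc i) ≡ 1)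

PseudoConvex : Benzenoid → Set
PseudoConvex B = ∃[ c ] (IsCode B c × 1 ∈ c × 2 ∉ c × No11 c)

-- Every entry of a boundary-edges code
-- counts at least one edge, so an entry of a pseudo-convex code that is not
-- 1 is at least 3 (there are no 2s); as no two consecutive entries are both
-- 1, every two cyclically consecutive entries sum to at least 4, i.e. the
-- code is 1-convex.  It is not 0-convex because it contains the entry 1.
--
-- Part 2 exhibits a concrete benzenoid B₀: a column of three hexagons with a
-- fourth one attached beside the bottom one.  Its perimeter is a 16-cycle and
-- its code is 5 2 4 4 1, which is 1-convex but not 0-convex, and contains 2.
-- The difficulty is that the code is defined as a maximum over ALL perimeter
-- traversals.  We prove, for an arbitrary benzenoid, that a traversal is
-- determined by its first two vertices: if a closed perimeter walk W of
-- distinct vertices is forced (every vertex of it has exactly its two walk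
-- neighbours as perimeter neighbours), then a traversal starting with W₀ W₁
-- is W itself.  For B₀ the finitely many possible first steps (a corner of a
-- hexagon of B₀ and one of its perimeter neighbours) are enumerated, the
-- forced walk from each is computed, and decision procedures check that each
-- is a forced 16-cycle whose gap sequence is lexicographically at most
-- 5 2 4 4 1 and contains a 2.  This yields both halves of the theorem for B₀.
module Submission where

open import Defs
open import Data.Nat using (ℕ; zero; suc; pred; _+_; _≤_; _<_; z≤n; s≤s; s≤s⁻¹; _%_; _≤?_; _≟_)
open import Data.Nat.Properties
  using (≤-trans; <-trans; ≤-refl; n<1+n; <⇒≤; ≮⇒≥; ≤-antisym; n≤1+n; m≤n+m; m≤m⊔n;
         m<1+n⇒m<n∨m≡n; <⇒≱; m≤n⊔m; +-comm; +-identityʳ; allUpTo?; anyUpTo?)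
open import Data.Nat.DivMod using (m%n<n; m<n⇒m%n≡m; n%n≡0)
open import Data.Integer as ℤ using (ℤ; +_; -[1+_]; ∣_∣)
import Data.Integer.Properties as ℤP
import Data.Bool as Bool
open import Data.Unit using (tt)
open import Data.List using (List; []; _∷_; length; map; filter; concatMap; applyUpTo)
open import Data.List.Membership.Propositional using (_∈_; _∉_)
open import Data.List.Membership.Propositional.Properties
  using (∈-map⁺; ∈-map⁻; ∈-filter⁺; ∈-filter⁻; ∈-concatMap⁺)
import Data.List.Membership.DecPropositional as DecMembership
open import Data.List.Relation.Unary.Any as Any using (here; there)
open import Data.List.Relation.Unary.All as All using (All; []; _∷_)
open import Data.List.Relation.Unary.AllPairs using (_∷_)
open import Data.List.Relation.Unary.Unique.Propositional using (Unique)
open import Data.List.Relation.Unary.Unique.DecPropositional using (unique?)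
open import Data.List.Relation.Binary.Lex.NonStrict using (Lex-≤; ≤-decidable)
open import Data.Product using (∃-syntax; _×_; _,_; proj₁; proj₂)
open import Data.Product.Properties using (≡-dec)
open import Data.Sum using (_⊎_; inj₁; inj₂)
open import Data.Empty using (⊥-elim)
open import Function using (_∘_)
open import Relation.Nullary using (¬_; Dec; yes; no; ¬?)
open import Relation.Nullary.Decidable using (_⊎-dec_; _×-dec_; toWitness; map′)
open import Relation.Binary.PropositionalEquality
  using (_≡_; _≢_; refl; subst; sym; trans; cong; cong₂)

open DecMembership _≟H_ using (_∈?_)

nthD-∈ : {A : Set} (d : A) (l : List A) (i : ℕ) → i < length l → nthD d l i ∈ l
nthD-∈ d (x ∷ l) zero    _         = here refl
nthD-∈ d (x ∷ l) (suc i) (s≤s i<l) = there (nthD-∈ d l i i<l)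

cyc-∈ : {A : Set} (d : A) {x : A} (l : List A) → x ∈ l → ∀ i → cyc d l i ∈ l
cyc-∈ d (y ∷ l) _ i = nthD-∈ d (y ∷ l) (i % suc (length l)) (m%n<n i (suc (length l)))

cyc-nth : {A : Set} (d : A) (l : List A) (i : ℕ) → i < length l → cyc d l i ≡ nthD d l i
cyc-nth d (x ∷ l) i i<l = cong (nthD d (x ∷ l)) (m<n⇒m%n≡m i<l)

cyc-length : {A : Set} (d : A) (x : A) (l : List A) →
             cyc d (x ∷ l) (length (x ∷ l)) ≡ x
cyc-length d x l = cong (nthD d (x ∷ l)) (n%n≡0 (suc (length l)))

∈⇒index : {A : Set} (d : A) {x : A} (l : List A) → x ∈ l →
          ∃[ i ] (i < length l × nthD d l i ≡ x)
∈⇒index d (y ∷ l) (here refl) = 0 , s≤s z≤n , refl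
∈⇒index d (y ∷ l) (there x∈l) with ∈⇒index d l x∈l
... | i , i<l , eq = suc i , s≤s i<l , eq

unique-nthD : {A : Set} (d : A) (l : List A) → Unique l →
              ∀ {i j} → i < j → j < length l → nthD d l i ≢ nthD d l j
unique-nthD d (x ∷ l) (x∉ ∷ _) {zero} {suc j} _ (s≤s j<l) = All.lookup x∉ (nthD-∈ d l j j<l)
unique-nthD d (x ∷ l) (_ ∷ u) {suc i} {suc j} (s≤s i<j) (s≤s j<l) = unique-nthD d l u i<j j<l

applyUpTo-ext : {A : Set} (d : A) (l : List A) (f : ℕ → A) (n : ℕ) → length l ≡ n →
                (∀ i → i < n → nthD d l i ≡ f i) → l ≡ applyUpTo f n
applyUpTo-ext d []      f zero    _   _  = refl
applyUpTo-ext d (x ∷ l) f (suc n) len entries =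
  cong₂ _∷_ (entries 0 (s≤s z≤n))
            (applyUpTo-ext d l (f ∘ suc) n (cong pred len) (λ i i<n → entries (suc i) (s≤s i<n)))

gaps-positive : ∀ bs → All (1 ≤_) (gaps bs)
gaps-positive []             = []
gaps-positive (Bool.false ∷ bs) = gaps-positive bs
gaps-positive (Bool.true  ∷ bs) = s≤s z≤n ∷ gaps-positive bs

pair-sum≥4 : ∀ a b → 1 ≤ a → 1 ≤ b → a ≢ 2 → b ≢ 2 → ¬ (a ≡ 1 × b ≡ 1) → 4 ≤ a + b
pair-sum≥4 1 1 _ _ _ _ not11 = ⊥-elim (not11 (refl , refl))
pair-sum≥4 1 2 _ _ _ b≢2 _ = ⊥-elim (b≢2 refl)
pair-sum≥4 1 (suc (suc (suc b))) _ _ _ _ _ = s≤s (s≤s (s≤s (s≤s z≤n)))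
pair-sum≥4 2 _ _ _ a≢2 _ _ = ⊥-elim (a≢2 refl)
pair-sum≥4 (suc (suc (suc a))) (suc b) _ _ _ _ _ =
  s≤s (s≤s (s≤s (≤-trans (s≤s z≤n) (m≤n+m (suc b) a))))

small-entry⇒¬0-convex : ∀ c {x} → x ∈ c → x < 2 → ¬ KConvex 0 c
small-entry⇒¬0-convex c x∈c x<2 convex with ∈⇒index 0 c x∈c
... | i , i<c , cᵢ≡x =
  <⇒≱ x<2 (subst (2 ≤_) (trans (+-identityʳ _) (trans (cyc-nth 0 c i i<c) cᵢ≡x)) (convex i i<c))

cd≡1 : ∀ c → KConvex 1 c → ¬ KConvex 0 c → HasCD c 1
cd≡1 c convex₁ ¬convex₀ = convex₁ , λ { zero _ → ¬convex₀ ; (suc k) (s≤s ()) }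

pseudoConvex⇒quasiConvex : (B : Benzenoid) → PseudoConvex B → QuasiConvex B
pseudoConvex⇒quasiConvex B (c , isCode@((v , vs , _ , _ , c≡gaps) , _) , 1∈c , 2∉c , no11) =
  c , isCode , cd≡1 c convex₁ (small-entry⇒¬0-convex c 1∈c (s≤s (s≤s z≤n)))
  where
  positive : ∀ i → 1 ≤ cyc 0 c i
  positive i = All.lookup (subst (All (1 ≤_)) (sym c≡gaps) (gaps-positive (flags B (v ∷ vs))))
                          (cyc-∈ 0 c 1∈c i)

  not2 : ∀ i → cyc 0 c i ≢ 2
  not2 i eq = 2∉c (subst (_∈ c) eq (cyc-∈ 0 c 1∈c i))

  convex₁ : KConvex 1 c
  convex₁ i i<c = subst (λ t → 4 ≤ cyc 0 c i + t) (sym (+-identityʳ _))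
    (pair-sum≥4 _ _ (positive i) (positive (suc i)) (not2 i) (not2 (suc i)) (no11 i i<c))

_≟V_ : (v w : Vtx) → Dec (v ≡ w)
_≟V_ = ≡-dec ℤ._≟_ (≡-dec ℤ._≟_ Bool._≟_)

open DecMembership _≟V_ using () renaming (_∈?_ to _∈V?_)

module Perimeter (B : Benzenoid) where

  perimEdge? : (e : Vtx × Hex × Hex) → Dec (PerimEdge B (proj₁ (proj₂ e)) (proj₂ (proj₂ e)))
  perimEdge? (_ , a , b) = ((a ∈? hexes B) ×-dec ¬? (b ∈? hexes B))
                           ⊎-dec (¬? (a ∈? hexes B) ×-dec (b ∈? hexes B))

  perimNbrs : Vtx → List Vtx
  perimNbrs v = map proj₁ (filter perimEdge? (nbrs v))

  perimNbrs-complete : ∀ {v w a b} → LatEdge v w a b → PerimEdge B a b → w ∈ perimNbrs v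
  perimNbrs-complete le pe = ∈-map⁺ proj₁ (∈-filter⁺ perimEdge? le pe)

  perimNbrs-sound : ∀ {v w} → w ∈ perimNbrs v → ∃[ a ] ∃[ b ] (LatEdge v w a b × PerimEdge B a b)
  perimNbrs-sound {v} w∈ with ∈-map⁻ proj₁ w∈
  ... | (_ , a , b) , e∈ , refl with ∈-filter⁻ perimEdge? {xs = nbrs v} e∈
  ...   | le , pe = a , b , le , pe

  -- the corners of a hexagon are the vertices of the triangles containing
  -- its centre (three "up" and three "down" triangles)
  corners : Hex → List Vtx
  corners (q , r) =
      (q , r , Bool.true) ∷ (q ℤ.- + 1 , r , Bool.true) ∷ (q , r ℤ.- + 1 , Bool.true)
    ∷ (q ℤ.- + 1 , r , Bool.false) ∷ (q , r ℤ.- + 1 , Bool.false)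
    ∷ (q ℤ.- + 1 , r ℤ.- + 1 , Bool.false) ∷ []

  cornerVertices : List Vtx
  cornerVertices = concatMap corners (hexes B)

  private
    +1-1 : ∀ q → q ≡ (q ℤ.+ + 1) ℤ.- + 1
    +1-1 q = sym (trans (ℤP.+-assoc q (+ 1) (ℤ.- + 1)) (ℤP.+-identityʳ q))

  edge-corners : ∀ {v w a b} → LatEdge v w a b → v ∈ corners a × v ∈ corners b
  edge-corners {q , r , Bool.true} (here refl) =
    there (here (cong (λ x → x , r , Bool.true) (+1-1 q))) ,
    there (there (here (cong (λ x → q , x , Bool.true) (+1-1 r))))
  edge-corners {q , r , Bool.true} (there (here refl)) =
    here refl , there (there (here (cong (λ x → q , x , Bool.true) (+1-1 r))))
  edge-corners {q , r , Bool.true} (there (there (here refl))) =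
    here refl , there (here (cong (λ x → x , r , Bool.true) (+1-1 q)))
  edge-corners {q , r , Bool.false} (here refl) =
    there (there (there (here (cong (λ x → x , r , Bool.false) (+1-1 q))))) ,
    there (there (there (there (here (cong (λ x → q , x , Bool.false) (+1-1 r))))))
  edge-corners {q , r , Bool.false} (there (here refl)) =
    there (there (there (here (cong (λ x → x , r , Bool.false) (+1-1 q))))) ,
    there (there (there (there (there (here (cong₂ (λ x y → x , y , Bool.false) (+1-1 q) (+1-1 r)))))))
  edge-corners {q , r , Bool.false} (there (there (here refl))) =
    there (there (there (there (here (cong (λ x → q , x , Bool.false) (+1-1 r)))))) ,
    there (there (there (there (there (here (cong₂ (λ x y → x , y , Bool.false) (+1-1 q) (+1-1 r)))))))

  perim⇒corner : ∀ {v w a b} → LatEdge v w a b → PerimEdge B a b → v ∈ cornerVertices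
  perim⇒corner le (inj₁ (a∈ , _)) = ∈-concatMap⁺ corners (Any.map (λ { refl → proj₁ (edge-corners le) }) a∈)
  perim⇒corner le (inj₂ (_ , b∈)) = ∈-concatMap⁺ corners (Any.map (λ { refl → proj₂ (edge-corners le) }) b∈)

  record ForcedCycle (n : ℕ) (W : ℕ → Vtx) : Set where
    field
      forced   : ∀ {k} → k < n → All (λ y → y ≡ W k ⊎ y ≡ W (2 + k)) (perimNbrs (W (1 + k)))
      closed   : W (suc n) ≡ W 0
      no-repeat : ∀ {m} → m < suc n → ∀ {j} → j < m → W m ≢ W j
      adjacent : ∀ {m} → m < n → W (suc m) ∈ perimNbrs (W m)

  forcedCycle? : ∀ n W → Dec (ForcedCycle n W)
  forcedCycle? n W =
    map′ (λ (f , c , d , a) → record { forced = λ {k} → f {k} ; closed = c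
                                      ; no-repeat = λ {m} → d {m} ; adjacent = λ {m} → a {m} })
         (λ fc → let open ForcedCycle fc
                 in (λ {k} → forced {k}) , closed , (λ {m} → no-repeat {m}) , (λ {m} → adjacent {m}))
         (allUpTo? (λ k → All.all? (λ y → (y ≟V W k) ⊎-dec (y ≟V W (2 + k))) (perimNbrs (W (1 + k)))) n
          ×-dec (W (suc n) ≟V W 0)
          ×-dec allUpTo? (λ m → allUpTo? (λ j → ¬? (W m ≟V W j)) m) (suc n)
          ×-dec allUpTo? (λ m → W (suc m) ∈V? perimNbrs (W m)) n)

  module TraversalIsForced
    {v : Vtx} {vs : List Vtx} (T : PerimTraversal B (v ∷ vs))
    {n : ℕ} {W : ℕ → Vtx} (cycle : ForcedCycle n W)
    (start₀ : v ≡ W 0) (start₁ : cyc dummyV (v ∷ vs) 1 ≡ W 1) where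

    open PerimTraversal T
    open ForcedCycle cycle

    L : List Vtx
    L = v ∷ vs

    x : ℕ → Vtx
    x = cyc dummyV L

    x-distinct : ∀ {i j} → i < j → j < length L → x i ≢ x j
    x-distinct i<j j<L eq = unique-nthD dummyV L distinct i<j j<L
      (trans (sym (cyc-nth dummyV L _ (<-trans i<j j<L))) (trans eq (cyc-nth dummyV L _ j<L)))

    -- one forced step: agreeing with W at k and k+1, the traversal must
    -- continue to W_{k+2}, since going back to W_k would repeat a vertex
    forced-step : ∀ k → 2 + k < length L → 2 + k ≤ suc n →
                  x k ≡ W k → x (1 + k) ≡ W (1 + k) → x (2 + k) ≡ W (2 + k)
    forced-step k k+2<L (s≤s k<n) xₖ≡ xₖ₊₁≡ with steps (1 + k) (<-trans (n<1+n (suc k)) k+2<L)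
    ... | a , b , le , pe
        with All.lookup (forced k<n) (subst (λ z → x (2 + k) ∈ perimNbrs z) xₖ₊₁≡ (perimNbrs-complete le pe))
    ...   | inj₂ eq = eq
    ...   | inj₁ eq = ⊥-elim (x-distinct (n≤1+n (suc k)) k+2<L (trans xₖ≡ (sym eq)))

    agree : ∀ i → i < length L → i ≤ suc n → x i ≡ W i
    agree zero          _     _     = start₀
    agree (suc zero)    _     _     = start₁
    agree (suc (suc k)) k+2<L k+2≤N = forced-step k k+2<L k+2≤N
      (agree k (<-trans (n≤1+n (suc k)) k+2<L) (≤-trans (≤-trans (n≤1+n k) (n≤1+n (suc k))) k+2≤N))
      (agree (suc k) (<-trans (n<1+n (suc k)) k+2<L) (≤-trans (n≤1+n (suc k)) k+2≤N))

    -- the traversal is no longer than the cycle: it would revisit W₀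
    length≤ : length L ≤ suc n
    length≤ = ≮⇒≥ λ N<L → x-distinct (s≤s z≤n) N<L
      (sym (trans (agree (suc n) N<L ≤-refl) (trans closed (sym start₀))))

    -- ... nor shorter: the cycle edge leaving W_{|L|-1} must be traversed,
    -- but both its ends are already used elsewhere by the traversal
    ≤length : suc n ≤ length L
    ≤length = ≮⇒≥ shorter-impossible
      where
      shorter-impossible : ¬ (length L < suc n)
      shorter-impossible L<N with perimNbrs-sound {W (length vs)} (adjacent {length vs} (s≤s⁻¹ L<N))
      ... | a , b , le , pe with covers _ _ a b le pe
      ... | i , i<L , inj₂ (xᵢ≡ , _) =
            no-repeat L<N i<L (trans (sym xᵢ≡) (agree i i<L (<⇒≤ (<-trans i<L L<N))))
      ... | i , i<L , inj₁ (_ , xᵢ₊₁≡) with m<1+n⇒m<n∨m≡n i<L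
      ...   | inj₁ i<vs = no-repeat L<N (s≤s i<vs)
                (trans (sym xᵢ₊₁≡) (agree (suc i) (s≤s i<vs) (<⇒≤ (<-trans (s≤s i<vs) L<N))))
      ...   | inj₂ refl = no-repeat L<N (s≤s z≤n)
                (trans (sym xᵢ₊₁≡) (trans (cyc-length dummyV v vs) start₀))

    traversal≡cycle : L ≡ applyUpTo W (suc n)
    traversal≡cycle = applyUpTo-ext dummyV L W (suc n) len≡
      (λ i i<N → let i<L = subst (i <_) (sym len≡) i<N
                 in trans (sym (cyc-nth dummyV L i i<L)) (agree i i<L (<⇒≤ i<N)))
      where len≡ = ≤-antisym length≤ ≤length

chainPath : {P : Hex → Set} (f : ℕ → Hex) → (∀ m → HexAdj (f m) (f (suc m))) →
            (∀ m → P (f m)) → ∀ k → HexPath P (f 0) (f k)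
chainPath f adj p zero    = here (p 0)
chainPath f adj p (suc k) = step (p 0) (adj 0) (chainPath (f ∘ suc) (adj ∘ suc) (p ∘ suc) k)

∣q∣≤norm : ∀ q r → ∣ q ∣ ≤ norm (q , r)
∣q∣≤norm q r = ≤-trans (m≤m⊔n ∣ q ∣ ∣ r ∣) (m≤m⊔n _ ∣ q ℤ.+ r ∣)

∣r∣≤norm : ∀ q r → ∣ r ∣ ≤ norm (q , r)
∣r∣≤norm q r = ≤-trans (m≤n⊔m ∣ q ∣ ∣ r ∣) (m≤m⊔n _ ∣ q ℤ.+ r ∣)

H₀ : List Hex
H₀ = (+ 0 , + 0) ∷ (+ 0 , + 1) ∷ (+ 0 , + 2) ∷ (+ 1 , + 0) ∷ []

origin : Hex
origin = (+ 0 , + 0)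

toOrigin : ∀ h → h ∈ H₀ → HexPath (_∈ H₀) h origin
toOrigin _ (here refl) = here (here refl)
toOrigin _ (there (here refl)) =
  step (there (here refl)) ((+ 0 , -[1+ 0 ]) , there (there (there (here refl))) , refl) (here (here refl))
toOrigin _ (there (there (here refl))) =
  step (there (there (here refl))) ((+ 0 , -[1+ 0 ]) , there (there (there (here refl))) , refl)
       (toOrigin _ (there (here refl)))
toOrigin _ (there (there (there (here refl)))) =
  step (there (there (there (here refl)))) ((-[1+ 0 ] , + 0) , there (here refl) , refl) (here (here refl))

fromOrigin : ∀ h → h ∈ H₀ → HexPath (_∈ H₀) origin h
fromOrigin _ (here refl) = here (here refl)
fromOrigin _ (there (here refl)) =
  step (here refl) ((+ 0 , + 1) , there (there (here refl)) , refl) (here (there (here refl)))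
fromOrigin _ (there (there (here refl))) =
  step (here refl) ((+ 0 , + 1) , there (there (here refl)) , refl)
    (step (there (here refl)) ((+ 0 , + 1) , there (there (here refl)) , refl) (here (there (there (here refl)))))
fromOrigin _ (there (there (there (here refl)))) =
  step (here refl) ((+ 1 , + 0) , here refl , refl) (here (there (there (there (here refl)))))

_++ᴾ_ : ∀ {P : Hex → Set} {h k g} → HexPath P h k → HexPath P k g → HexPath P h g
here _       ++ᴾ q = q
step p a rest ++ᴾ q = step p a (rest ++ᴾ q)

H₀-connected : ∀ h g → h ∈ H₀ → g ∈ H₀ → HexPath (_∈ H₀) h g
H₀-connected h g h∈ g∈ = toOrigin h h∈ ++ᴾ fromOrigin g g∈

H₀-small : All (λ k → norm k ≤ 2) H₀
H₀-small = z≤n ∷ s≤s z≤n ∷ s≤s (s≤s z≤n) ∷ s≤s z≤n ∷ []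

far : ∀ g → 3 ≤ norm g → ∀ k → k ∈ H₀ → norm k < norm g
far g 3≤g k k∈ = ≤-trans (s≤s (All.lookup H₀-small k∈)) 3≤g

∉H₀-east : ∀ n r → (+ suc (suc n) , r) ∉ H₀
∉H₀-east n r = λ { (here ()) ; (there (here ())) ; (there (there (here ())))
                 ; (there (there (there (here ())))) }

∉H₀-west : ∀ n r → (-[1+ n ] , r) ∉ H₀
∉H₀-west n r = λ { (here ()) ; (there (here ())) ; (there (there (here ())))
                 ; (there (there (there (here ())))) }

∉H₀-south : ∀ q n → (q , -[1+ n ]) ∉ H₀
∉H₀-south q n = λ { (here ()) ; (there (here ())) ; (there (there (here ())))
                  ; (there (there (there (here ())))) }

-- no holes: from a hexagon outside H₀ a straight ray (east, west, south, or
-- north along the column) reaches distance ≥ 3 without meeting H₀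
H₀-holeFree : ∀ h → h ∉ H₀ → ∃[ g ] ((∀ k → k ∈ H₀ → norm k < norm g) × HexPath (_∉ H₀) h g)
H₀-holeFree (+ suc n , r) h∉ =
  east 3 , far (east 3) (≤-trans (s≤s (s≤s (s≤s z≤n))) (∣q∣≤norm (+ suc (3 + n)) r))
         , chainPath east adj outside 3
  where
  east : ℕ → Hex
  east m = (+ suc (m + n) , r)
  adj : ∀ m → HexAdj (east m) (east (suc m))
  adj m = (+ 1 , + 0) , here refl ,
          cong₂ _,_ (cong (λ t → + suc t) (sym (+-comm (m + n) 1))) (sym (ℤP.+-identityʳ r))
  outside : ∀ m → east m ∉ H₀
  outside zero    = h∉
  outside (suc m) = ∉H₀-east (m + n) r
H₀-holeFree (-[1+ n ] , r) _ =
  west 3 , far (west 3) (≤-trans (s≤s (s≤s (s≤s z≤n))) (∣q∣≤norm -[1+ (3 + n) ] r))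
         , chainPath west adj outside 3
  where
  west : ℕ → Hex
  west m = (-[1+ (m + n) ] , r)
  adj : ∀ m → HexAdj (west m) (west (suc m))
  adj m = (-[1+ 0 ] , + 0) , there (here refl) ,
          cong₂ _,_ (cong (λ t → -[1+ suc t ]) (sym (+-identityʳ (m + n)))) (sym (ℤP.+-identityʳ r))
  outside : ∀ m → west m ∉ H₀
  outside m = ∉H₀-west (m + n) r
H₀-holeFree (+ zero , -[1+ n ]) _ =
  south 3 , far (south 3) (≤-trans (s≤s (s≤s (s≤s z≤n))) (∣r∣≤norm (+ 0) -[1+ (3 + n) ]))
          , chainPath south adj outside 3
  where
  south : ℕ → Hex
  south m = (+ 0 , -[1+ (m + n) ])
  adj : ∀ m → HexAdj (south m) (south (suc m))
  adj m = (+ 0 , -[1+ 0 ]) , there (there (there (here refl))) ,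
          cong (λ t → (+ 0 , -[1+ suc t ])) (sym (+-identityʳ (m + n)))
  outside : ∀ m → south m ∉ H₀
  outside m = ∉H₀-south (+ 0) (m + n)
H₀-holeFree (+ zero , + zero) h∉ = ⊥-elim (h∉ (here refl))
H₀-holeFree (+ zero , + 1) h∉ = ⊥-elim (h∉ (there (here refl)))
H₀-holeFree (+ zero , + 2) h∉ = ⊥-elim (h∉ (there (there (here refl))))
H₀-holeFree h@(+ zero , + suc (suc (suc m))) h∉ =
  h , far h (≤-trans (s≤s (s≤s (s≤s z≤n))) (∣r∣≤norm (+ 0) (+ suc (suc (suc m))))) , here h∉

B₀ : Benzenoid
B₀ = record { hexes = H₀ ; nonEmpty = origin , here refl
            ; connected = H₀-connected ; holeFree = H₀-holeFree }

open Perimeter B₀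

-- the boundary-edges code of B₀ (read off traversal₀ below)
code₀ : List ℕ
code₀ = 5 ∷ 2 ∷ 4 ∷ 4 ∷ 1 ∷ []

Dominated : List ℕ → Set
Dominated c = Lex-≤ _≡_ _≤_ c code₀ × 2 ∈ c

dominated? : ∀ c → Dec (Dominated c)
dominated? c = ≤-decidable _≟_ _≤?_ c code₀ ×-dec DecMembership._∈?_ _≟_ 2 c

nextVertex : Vtx → Vtx → Vtx
nextVertex p c = other (perimNbrs c)
  where
  other : List Vtx → Vtx
  other []       = c
  other (y ∷ ys) with y ≟V p
  ... | yes _ = other ys
  ... | no  _ = y

walkFrom : ℕ → Vtx → Vtx → List Vtx
walkFrom zero    p c = []
walkFrom (suc k) p c = p ∷ walkFrom k c (nextVertex p c)

-- the walk is kept opaque, so that only the decision procedure below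
-- evaluates it (unfolding it during unification is prohibitively expensive)
opaque
  walk : Vtx → Vtx → ℕ → Vtx
  walk p c = nthD dummyV (walkFrom 17 p c)

  walk-0 : ∀ p c → p ≡ walk p c 0
  walk-0 p c = refl

  walk-1 : ∀ p c → c ≡ walk p c 1
  walk-1 p c = refl

GoodStart : Vtx → Vtx → Set
GoodStart p c = ForcedCycle 15 (walk p c)
                × (¬ Deg3 B₀ p ⊎ Dominated (gaps (flags B₀ (applyUpTo (walk p c) 16))))

opaque
  unfolding walk

  all-starts-good : All (λ p → All (GoodStart p) (perimNbrs p)) cornerVertices
  all-starts-good = toWitness {a? = All.all? (λ p → All.all? (λ c →
    forcedCycle? 15 (walk p c) ×-dec (¬? (deg3? B₀ p) ⊎-dec dominated? _)) (perimNbrs p)) cornerVertices} tt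

gapSeq-dominated : ∀ c → IsGapSeq B₀ c → Dominated c
gapSeq-dominated c (v , vs , T , deg3 , c≡gaps) with PerimTraversal.steps T 0 (s≤s z≤n)
... | a , b , le , pe with All.lookup (All.lookup all-starts-good (perim⇒corner le pe))
                                      (perimNbrs-complete le pe)
...   | cycle , inj₁ ¬deg3   = ⊥-elim (¬deg3 deg3)
...   | cycle , inj₂ dominated =
  subst Dominated (sym (trans c≡gaps (cong (gaps ∘ flags B₀) traversal≡cycle))) dominated
  where open TraversalIsForced T cycle (walk-0 _ _) (walk-1 _ _)

start₀ : Vtx
start₀ = (+ 0 , + 1 , Bool.true)

perimeter₀ : List Vtx
perimeter₀ =
    (+ 0 , + 1 , Bool.false) ∷ (+ 0 , + 2 , Bool.true) ∷ (-[1+ 0 ] , + 2 , Bool.false)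
  ∷ (-[1+ 0 ] , + 2 , Bool.true) ∷ (-[1+ 0 ] , + 1 , Bool.false) ∷ (-[1+ 0 ] , + 1 , Bool.true)
  ∷ (-[1+ 0 ] , + 0 , Bool.false) ∷ (-[1+ 0 ] , + 0 , Bool.true) ∷ (-[1+ 0 ] , -[1+ 0 ] , Bool.false)
  ∷ (+ 0 , -[1+ 0 ] , Bool.true) ∷ (+ 0 , -[1+ 0 ] , Bool.false) ∷ (+ 1 , -[1+ 0 ] , Bool.true)
  ∷ (+ 1 , -[1+ 0 ] , Bool.false) ∷ (+ 1 , + 0 , Bool.true) ∷ (+ 0 , + 0 , Bool.false) ∷ []

private
  τ : ℕ → Vtx
  τ = cyc dummyV (start₀ ∷ perimeter₀)

  TraversedAt : Vtx → Vtx → ℕ → Set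
  TraversedAt v w i = (τ i ≡ v × τ (suc i) ≡ w) ⊎ (τ i ≡ w × τ (suc i) ≡ v)

  steps₀ : ∀ {i} → i < 16 → τ (suc i) ∈ perimNbrs (τ i)
  steps₀ = toWitness {a? = allUpTo? (λ i → τ (suc i) ∈V? perimNbrs (τ i)) 16} tt

  covers₀ : All (λ v → All (λ w → ∃[ i ] (i < 16 × TraversedAt v w i)) (perimNbrs v)) cornerVertices
  covers₀ = toWitness {a? = All.all? (λ v → All.all? (λ w → anyUpTo? (λ i →
    ((τ i ≟V v) ×-dec (τ (suc i) ≟V w)) ⊎-dec ((τ i ≟V w) ×-dec (τ (suc i) ≟V v))) 16)
    (perimNbrs v)) cornerVertices} tt

traversal₀ : PerimTraversal B₀ (start₀ ∷ perimeter₀)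
traversal₀ = record
  { distinct = toWitness {a? = unique? _≟V_ (start₀ ∷ perimeter₀)} tt
  ; steps    = λ i i<16 → perimNbrs-sound (steps₀ i<16)
  ; covers   = λ v w a b le pe →
      All.lookup (All.lookup covers₀ (perim⇒corner le pe)) (perimNbrs-complete le pe)
  }

code₀-isCode : IsCode B₀ code₀
code₀-isCode = (start₀ , perimeter₀ , traversal₀ , toWitness {a? = deg3? B₀ start₀} tt , refl)
             , λ c isGapSeq → proj₁ (gapSeq-dominated c isGapSeq)

code₀-cd≡1 : HasCD code₀ 1
code₀-cd≡1 = cd≡1 code₀ (λ _ i<5 → convex i<5)
  (small-entry⇒¬0-convex code₀ (there (there (there (there (here refl))))) (s≤s (s≤s z≤n)))
  where
  convex : ∀ {i} → i < 5 → 4 ≤ blockSum code₀ i 2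
  convex = toWitness {a? = allUpTo? (λ i → 4 ≤? blockSum code₀ i 2) 5} tt

B₀-quasiConvex : QuasiConvex B₀
B₀-quasiConvex = code₀ , code₀-isCode , code₀-cd≡1

-- any code of B₀ is a gap sequence, hence contains 2
B₀-not-pseudoConvex : ¬ PseudoConvex B₀
B₀-not-pseudoConvex (c , (isGapSeq , _) , _ , 2∉c , _) = 2∉c (proj₂ (gapSeq-dominated c isGapSeq))

mainTheorem5 : ((B : Benzenoid) → PseudoConvex B → QuasiConvex B)
               × (∃[ B ] (QuasiConvex B × ¬ PseudoConvex B))
mainTheorem5 = pseudoConvex⇒quasiConvex , B₀ , B₀-quasiConvex , B₀-not-pseudoConvex
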